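{- Let $G$ be a graph, $r\geq 1$, and let $D,D'$ be effective divisors on $G$ such that $D'$ is obtained from $D$ by firing the set $U\subseteq V(G)$. Let $B\subseteq V(G)$ be such that $G[B]$ is $r$-edge-connected, and suppose that $B$ $r$-intersects $\mathrm{msupp}(D)$ but does not $r$-intersect $\mathrm{msupp}(D')$. Then $B\subseteq U$.
   Context: A graph is a finite, connected, undirected multigraph without loops; $G[B]$ is the induced subgraph. $G[B]$ is $r$-edge-connected if it stays connected after removing any $r-1$ edges; a single vertex counts as $r$-edge-connected for every $r$. A divisor is a formal integer combination $D=\sum_v D(v)(v)$, effective if all $D(v)\ge0$. Firing a set $U$ transforms $D$ into $D'$ where each $v\in U$ sends one chip along each edge from $v$ to $V\setminus U$: $D'(v)=D(v)-|E(\{v\},V\setminus U)|$ for $v\in U$ and $D'(w)=D(w)+|E(\{w\},U)|$ for $w\notin U$. The multi-support $\mathrm{msupp}(D)$ of an effective $D$ is the multiset containing each $v$ exactly $D(v)$ times; $B$ $r$-intersects $\mathrm{msupp}(D)$ if $\sum_{v\in B}D(v)\geq r$. -}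

module Defs where

open import Data.Nat as ℕ using (ℕ; zero; suc)
open import Data.Integer as ℤ using (ℤ; +_)
open import Data.Bool using (Bool; true; false; if_then_else_)
open import Data.Fin using (Fin; zero; suc)
open import Data.Fin.Subset using (Subset; _∈_; ∁)
open import Data.Vec using (lookup)
open import Data.Product using (_×_; _,_)
open import Data.List using (List; length)
open import Data.List.Membership.Propositional using () renaming (_∈_ to _∈ₗ_)
open import Data.List.Relation.Binary.Sublist.Propositional using () renaming (_⊆_ to _⊑_)
open import Relation.Binary.PropositionalEquality using (_≡_)
open import Relation.Nullary using (¬_; does)
open import Data.Fin using (_≟_)

-- A finite multigraph on vertex set Fin n, given by a list of edges
-- (parallel edges = repeated entries).  Loops are forbidden.
record Graph : Set where
  field
    n        : ℕ
    edges    : List (Fin n × Fin n)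
    loopless : ∀ {a b} → (a , b) ∈ₗ edges → ¬ (a ≡ b)
open Graph public

data Reach {n : ℕ} (es : List (Fin n × Fin n)) : Fin n → Fin n → Set where
  here : ∀ {u} → Reach es u u
  fwd  : ∀ {u a b} → Reach es u a → (a , b) ∈ₗ es → Reach es u b
  bwd  : ∀ {u a b} → Reach es u b → (a , b) ∈ₗ es → Reach es u a

ConnectedOn : {n : ℕ} → Subset n → List (Fin n × Fin n) → Set
ConnectedOn B es = ∀ {u v} → u ∈ B → v ∈ B → Reach es u v

Connected : Graph → Set
Connected G = ∀ (u v : Fin (n G)) → Reach (edges G) u v

inducedEdges : (G : Graph) → Subset (n G) → List (Fin (n G) × Fin (n G))
inducedEdges G B = Data.List.filterᵇ (λ e → lookup B (Data.Product.proj₁ e) Data.Bool.∧ lookup B (Data.Product.proj₂ e)) (edges G)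

-- G[B] is r-edge-connected: for every sub-multiset es' of the edges of G[B]
-- obtained by deleting at most r-1 edges, (B, es') is connected
EdgeConnected : (G : Graph) → ℕ → Subset (n G) → Set
EdgeConnected G r B =
  ∀ (es' : List (Fin (n G) × Fin (n G))) → es' ⊑ inducedEdges G B →
    length (inducedEdges G B) ℕ.≤ length es' ℕ.+ (r ℕ.∸ 1) →
    ConnectedOn B es'

edgesTo : (G : Graph) → Fin (n G) → Subset (n G) → ℕ
edgesTo G v S = go (edges G)
  where
  ind : Bool → ℕ
  ind true = 1
  ind false = 0
  go : List (Fin (n G) × Fin (n G)) → ℕ
  go List.[] = 0
  go ((a , b) List.∷ es) =
    ind (does (a ≟ v) Data.Bool.∧ lookup S b) ℕ.+ ind (does (b ≟ v) Data.Bool.∧ lookup S a) ℕ.+ go es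

Divisor : Graph → Set
Divisor G = Fin (n G) → ℤ

Effective : (G : Graph) → Divisor G → Set
Effective G D = ∀ v → + 0 ℤ.≤ D v

fire : (G : Graph) → Subset (n G) → Divisor G → Divisor G
fire G U D v =
  if lookup U v then D v ℤ.- + edgesTo G v (∁ U)
                else D v ℤ.+ + edgesTo G v U

sumOver : {m : ℕ} → Subset m → (Fin m → ℤ) → ℤ
sumOver {zero} B f = + 0
sumOver {suc m} B f =
  (if lookup B zero then f zero else + 0) ℤ.+ sumOver {m} (Data.Vec.tail B) (λ i → f (suc i))

-- B r-intersects msupp(D): Σ_{v∈B} D(v) ≥ r
RIntersects : (G : Graph) → ℕ → Subset (n G) → Divisor G → Set
RIntersects G r B D = + r ℤ.≤ sumOver B D

{-# OPTIONS --safe #-}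
-- Suppose some x ∈ B lies outside U and count the edges of G[B] crossing the cut (U, V ∖ U).
-- If there are at least r, each sends a chip to its endpoint in B ∖ U while D' stays
-- non-negative on B ∩ U, so B r-intersects msupp(D'). If there are fewer than r, deleting
-- them leaves G[B] connected, so all of B lies outside U with x; firing then only adds chips
-- on B, and B r-intersects msupp(D') because it r-intersects msupp(D).
module Submission where

open import Defs
open import Data.Nat as ℕ using (ℕ; zero; suc; _≥_; z≤n; s≤s)
import Data.Nat.Properties as ℕ
open import Data.Integer using (ℤ; +_; +≤+; _+_; _≤_; nonNegative)
import Data.Integer.Properties as ℤ
open import Data.Bool using (Bool; true; false; _∧_; if_then_else_)
import Data.Bool.Properties as Bool
open import Data.Fin using (Fin; zero; suc; _≟_)
open import Data.Fin.Subset using (Subset; _∈_; _⊆_)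
open import Data.Vec using (_∷_; []; here; there; lookup)
open import Data.Vec.Properties using (lookup⇒[]=)
open import Data.Product using (_×_; _,_; proj₂)
open import Data.List using (List; []; _∷_; [_]; _++_; length; filter; filterᵇ; map)
open import Data.Nat.ListAction using (sum)
open import Data.Nat.ListAction.Properties using (sum-++)
open import Data.List.Properties using (length-++; filter-++; map-++)
open import Data.List.Membership.Propositional using () renaming (_∈_ to _∈ₗ_)
open import Data.List.Membership.Propositional.Properties using (∈-filter⁻)
open import Data.List.Relation.Binary.Sublist.Propositional.Properties using (filter-⊆)
open import Data.Empty using (⊥-elim)
open import Function using (_∘_)
open import Relation.Binary.PropositionalEquality using (_≡_; refl; sym; trans; cong; subst; subst₂; module ≡-Reasoning)
open import Relation.Nullary using (¬_; does; yes; no)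
open import Relation.Nullary.Decidable using (dec-true; T?)
open import Relation.Unary using (Decidable)
open import Relation.Unary.Properties using (∁?)
open import Algebra.Properties.CommutativeSemigroup ℤ.+-commutativeSemigroup using (interchange)

sumOver-mono : ∀ {m} (B : Subset m) {f g : Fin m → ℤ} →
  (∀ {v} → v ∈ B → f v ≤ g v) → sumOver B f ≤ sumOver B g
sumOver-mono {zero}  []          f≤g = ℤ.≤-refl
sumOver-mono {suc m} (true ∷ B)  f≤g = ℤ.+-mono-≤ (f≤g here) (sumOver-mono B (f≤g ∘ there))
sumOver-mono {suc m} (false ∷ B) f≤g = ℤ.+-monoʳ-≤ (+ 0) (sumOver-mono B (f≤g ∘ there))

sumOver-nonneg : ∀ {m} (B : Subset m) {f : Fin m → ℤ} →
  (∀ {v} → v ∈ B → + 0 ≤ f v) → + 0 ≤ sumOver B f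
sumOver-nonneg {zero}  []          f≥0 = ℤ.≤-refl
sumOver-nonneg {suc m} (true ∷ B)  f≥0 = ℤ.+-mono-≤ (f≥0 here) (sumOver-nonneg B (f≥0 ∘ there))
sumOver-nonneg {suc m} (false ∷ B) f≥0 = ℤ.+-mono-≤ (ℤ.≤-refl {+ 0}) (sumOver-nonneg B (f≥0 ∘ there))

≤-sumOver : ∀ {m} (B : Subset m) {f : Fin m → ℤ} →
  (∀ {v} → v ∈ B → + 0 ≤ f v) → ∀ {v} → v ∈ B → f v ≤ sumOver B f
≤-sumOver (true ∷ B) {f} f≥0 here =
  ℤ.i≤i+j (f zero) _ {{nonNegative (sumOver-nonneg B (f≥0 ∘ there))}}
≤-sumOver (true ∷ B) {f} f≥0 (there v∈B) =
  ℤ.i≤j⇒i≤k+j (f zero) {{nonNegative (f≥0 here)}} (≤-sumOver B (f≥0 ∘ there) v∈B)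
≤-sumOver (false ∷ B) f≥0 (there v∈B) = ℤ.i≤j⇒i≤k+j (+ 0) (≤-sumOver B (f≥0 ∘ there) v∈B)

sumOver-+ : ∀ {m} (B : Subset m) (f g : Fin m → ℤ) →
  sumOver B (λ v → f v + g v) ≡ sumOver B f + sumOver B g
sumOver-+ {zero}  []          f g = refl
sumOver-+ {suc m} (true ∷ B)  f g =
  trans (cong (_+_ (f zero + g zero)) (sumOver-+ B (f ∘ suc) (g ∘ suc)))
        (interchange (f zero) (g zero) (sumOver B (f ∘ suc)) (sumOver B (g ∘ suc)))
sumOver-+ {suc m} (false ∷ B) f g =
  trans (cong (_+_ (+ 0)) (sumOver-+ B (f ∘ suc) (g ∘ suc)))
        (interchange (+ 0) (+ 0) (sumOver B (f ∘ suc)) (sumOver B (g ∘ suc)))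

length-filter+filter-∁ : ∀ {A : Set} {P : A → Set} (P? : Decidable P) xs →
  length xs ≡ length (filter P? xs) ℕ.+ length (filter (∁? P?) xs)
length-filter+filter-∁ P? []       = refl
length-filter+filter-∁ P? (x ∷ xs) with does (P? x)
... | true  = cong suc (length-filter+filter-∁ P? xs)
... | false = trans (cong suc (length-filter+filter-∁ P? xs)) (sym (ℕ.+-suc _ _))

Edge : ℕ → Set
Edge k = Fin k × Fin k

iverson : Bool → ℕ
iverson true  = 1
iverson false = 0

incidences : ∀ {k} → Fin k → Subset k → Edge k → ℕ
incidences v S (a , b) = iverson (does (a ≟ v) ∧ lookup S b) ℕ.+ iverson (does (b ≟ v) ∧ lookup S a)

degreeIn : ∀ {k} → List (Edge k) → Fin k → Subset k → ℕ
degreeIn es v S = sum (map (incidences v S) es)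

module _ {k : ℕ} (v : Fin k) (S : Subset k) where

  degreeIn-unique : (F : List (Edge k) → ℕ) (K : Bool → Bool → List (Edge k) → ℕ) →
    F [] ≡ 0 →
    (∀ a b es → F ((a , b) ∷ es) ≡ K (does (a ≟ v) ∧ lookup S b) (does (b ≟ v) ∧ lookup S a) es) →
    (∀ es → K true true es ≡ 2 ℕ.+ F es) → (∀ es → K true false es ≡ 1 ℕ.+ F es) →
    (∀ es → K false true es ≡ 1 ℕ.+ F es) → (∀ es → K false false es ≡ F es) →
    ∀ x y es → K x y es ≡ iverson x ℕ.+ iverson y ℕ.+ degreeIn es v S
  degreeIn-unique F K F[] F∷ Ktt Ktf Kft Kff x y es =
    trans (K-step x y es) (cong (iverson x ℕ.+ iverson y ℕ.+_) (F≗degreeIn es))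
    where
    K-step : ∀ x y es → K x y es ≡ iverson x ℕ.+ iverson y ℕ.+ F es
    K-step true  true  = Ktt
    K-step true  false = Ktf
    K-step false true  = Kft
    K-step false false = Kff

    F≗degreeIn : ∀ es → F es ≡ degreeIn es v S
    F≗degreeIn []             = F[]
    F≗degreeIn ((a , b) ∷ es) =
      trans (F∷ a b es) (trans (K-step _ _ es) (cong (_ ℕ.+_) (F≗degreeIn es)))

-- edgesTo recurses through where-bound helpers that cannot be named outside Defs, so F and K
-- are left to unification: once edges G is abstracted, the goal pins them to those helpers.
edgesTo≡degreeIn : (G : Graph) (v : Fin (n G)) (S : Subset (n G)) →
  edgesTo G v S ≡ degreeIn (edges G) v S
edgesTo≡degreeIn G v S
  with edges G
     | degreeIn-unique v S _ _ refl (λ _ _ _ → refl) (λ _ → refl) (λ _ → refl) (λ _ → refl) (λ _ → refl)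
... | []           | _  = refl
... | (a , b) ∷ es | K≡ with does (a ≟ v) ∧ lookup S b | does (b ≟ v) ∧ lookup S a
...   | x | y = K≡ x y es

gain : ∀ {k} → Subset k → List (Edge k) → Fin k → ℕ
gain U es v = if lookup U v then 0 else degreeIn es v U

gain-++ : ∀ {k} (U : Subset k) xs ys v → gain U (xs ++ ys) v ≡ gain U xs v ℕ.+ gain U ys v
gain-++ U xs ys v with lookup U v
... | true  = refl
... | false = trans (cong sum (map-++ (incidences v U) xs ys))
                    (sum-++ (map (incidences v U) xs) (map (incidences v U) ys))

module _ {k : ℕ} (U : Subset k) {a b : Fin k} where

  1≤gain-source : lookup U a ≡ false → lookup U b ≡ true → 1 ℕ.≤ gain U [ (a , b) ] a
  1≤gain-source a∉U b∈U rewrite a∉U | b∈U | dec-true (a ≟ a) refl = s≤s z≤n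

  1≤gain-target : lookup U a ≡ true → lookup U b ≡ false → 1 ℕ.≤ gain U [ (a , b) ] b
  1≤gain-target a∈U b∉U rewrite a∈U | b∉U | dec-true (b ≟ b) refl | Bool.∧-zeroʳ (does (a ≟ b)) =
    s≤s z≤n

SameSide : ∀ {k} → Subset k → Edge k → Set
SameSide U (a , b) = lookup U a ≡ lookup U b

sameSide? : ∀ {k} (U : Subset k) → Decidable (SameSide U)
sameSide? U (a , b) = lookup U a Bool.≟ lookup U b

cutEdges : ∀ {k} → Subset k → List (Edge k) → List (Edge k)
cutEdges U = filter (∁? (sameSide? U))

bothIn : ∀ {k} → Subset k → Edge k → Bool
bothIn B (a , b) = lookup B a ∧ lookup B b

module _ {k : ℕ} (B U : Subset k) where

  crossing⇒1≤sumOver-gain : ∀ {a b} → a ∈ B → b ∈ B → ∀ {x y} → lookup U a ≡ x → lookup U b ≡ y → ¬ x ≡ y →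
    + 1 ≤ sumOver B (λ v → + gain U [ (a , b) ] v)
  crossing⇒1≤sumOver-gain a∈B b∈B {false} {true} a∉U b∈U _ =
    ℤ.≤-trans (+≤+ (1≤gain-source U a∉U b∈U)) (≤-sumOver B (λ _ → +≤+ z≤n) a∈B)
  crossing⇒1≤sumOver-gain a∈B b∈B {true} {false} a∈U b∉U _ =
    ℤ.≤-trans (+≤+ (1≤gain-target U a∈U b∉U)) (≤-sumOver B (λ _ → +≤+ z≤n) b∈B)
  crossing⇒1≤sumOver-gain _ _ {false} {false} _ _ x≢y = ⊥-elim (x≢y refl)
  crossing⇒1≤sumOver-gain _ _ {true}  {true}  _ _ x≢y = ⊥-elim (x≢y refl)

  cutIn : List (Edge k) → List (Edge k)
  cutIn es = cutEdges U (filterᵇ (bothIn B) es)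

  length-cutIn-single≤sumOver-gain : ∀ e → + length (cutIn [ e ]) ≤ sumOver B (λ v → + gain U [ e ] v)
  length-cutIn-single≤sumOver-gain (a , b) with lookup B a in a∈B | lookup B b in b∈B
  ... | false | _     = sumOver-nonneg B (λ _ → +≤+ z≤n)
  ... | true  | false = sumOver-nonneg B (λ _ → +≤+ z≤n)
  ... | true  | true  with sameSide? U (a , b)
  ...   | yes _       = sumOver-nonneg B (λ _ → +≤+ z≤n)
  ...   | no crossing =
    crossing⇒1≤sumOver-gain (lookup⇒[]= a B a∈B) (lookup⇒[]= b B b∈B) refl refl crossing

  length-cutIn-++ : ∀ xs ys → length (cutIn (xs ++ ys)) ≡ length (cutIn xs) ℕ.+ length (cutIn ys)
  length-cutIn-++ xs ys = begin
    length (cutIn (xs ++ ys))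
      ≡⟨ cong (length ∘ cutEdges U) (filter-++ (T? ∘ bothIn B) xs ys) ⟩
    length (cutEdges U (filterᵇ (bothIn B) xs ++ filterᵇ (bothIn B) ys))
      ≡⟨ cong length (filter-++ (∁? (sameSide? U)) (filterᵇ (bothIn B) xs) (filterᵇ (bothIn B) ys)) ⟩
    length (cutIn xs ++ cutIn ys)
      ≡⟨ length-++ (cutIn xs) ⟩
    length (cutIn xs) ℕ.+ length (cutIn ys) ∎
    where open ≡-Reasoning

  length-cutIn≤sumOver-gain : ∀ es → + length (cutIn es) ≤ sumOver B (λ v → + gain U es v)
  length-cutIn≤sumOver-gain []       = sumOver-nonneg B (λ _ → +≤+ z≤n)
  length-cutIn≤sumOver-gain (e ∷ es) = begin
    + length (cutIn ([ e ] ++ es))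
      ≡⟨ cong +_ (length-cutIn-++ [ e ] es) ⟩
    + (length (cutIn [ e ]) ℕ.+ length (cutIn es))
      ≡⟨ ℤ.pos-+ (length (cutIn [ e ])) _ ⟩
    + length (cutIn [ e ]) + + length (cutIn es)
      ≤⟨ ℤ.+-mono-≤ (length-cutIn-single≤sumOver-gain e) (length-cutIn≤sumOver-gain es) ⟩
    sumOver B (λ v → + gain U [ e ] v) + sumOver B (λ v → + gain U es v)
      ≡⟨ sumOver-+ B _ _ ⟨
    sumOver B (λ v → + gain U [ e ] v + + gain U es v)
      ≤⟨ sumOver-mono B (λ {v} _ → ℤ.≤-reflexive (split v)) ⟩
    sumOver B (λ v → + gain U (e ∷ es) v) ∎
    where
    open ℤ.≤-Reasoning
    split : ∀ v → + gain U [ e ] v + + gain U es v ≡ + gain U (e ∷ es) v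
    split v = trans (sym (ℤ.pos-+ (gain U [ e ] v) _)) (cong +_ (sym (gain-++ U [ e ] es v)))

Reach⇒sameSide : ∀ {k} (U : Subset k) {es : List (Edge k)} → (∀ {e} → e ∈ₗ es → SameSide U e) →
  ∀ {u v} → Reach es u v → lookup U u ≡ lookup U v
Reach⇒sameSide U same here        = refl
Reach⇒sameSide U same (fwd u~a e) = trans (Reach⇒sameSide U same u~a) (same e)
Reach⇒sameSide U same (bwd u~b e) = trans (Reach⇒sameSide U same u~b) (sym (same e))

small-cut⇒sameSide : (G : Graph) (r : ℕ) (B U : Subset (n G)) → EdgeConnected G r B →
  length (cutEdges U (inducedEdges G B)) ℕ.< r →
  ∀ {u v} → u ∈ B → v ∈ B → lookup U u ≡ lookup U v
small-cut⇒sameSide G r B U r-connected cut<r u∈B v∈B =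
  Reach⇒sameSide U (proj₂ ∘ ∈-filter⁻ (sameSide? U) {xs = induced}) (connected u∈B v∈B)
  where
  induced = inducedEdges G B
  uncut = filter (sameSide? U) induced
  connected : ConnectedOn B uncut
  connected = r-connected uncut (filter-⊆ (sameSide? U) induced) (begin
    length induced                                          ≡⟨ length-filter+filter-∁ (sameSide? U) induced ⟩
    length uncut ℕ.+ length (cutEdges U induced)            ≤⟨ ℕ.+-monoʳ-≤ (length uncut) (ℕ.∸-monoˡ-≤ 1 cut<r) ⟩
    length uncut ℕ.+ (r ℕ.∸ 1)                              ∎)
    where open ℕ.≤-Reasoning

module _ (G : Graph) (U : Subset (n G)) {D D' : Divisor G} (D'≗fire : ∀ v → D' v ≡ fire G U D v) where

  fired-outside : ∀ {v} → lookup U v ≡ false → D' v ≡ D v + + edgesTo G v U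
  fired-outside {v} v∉U rewrite D'≗fire v | v∉U = refl

  ≤-fired-outside : ∀ {v} → lookup U v ≡ false → D v ≤ D' v
  ≤-fired-outside {v} v∉U = subst (D v ≤_) (sym (fired-outside v∉U)) (ℤ.i≤i+j (D v) (+ edgesTo G v U))

  gain≤fired : Effective G D → Effective G D' → ∀ v → + gain U (edges G) v ≤ D' v
  gain≤fired effD effD' v with lookup U v in v∈?U
  ... | true  = effD' v
  ... | false = subst₂ _≤_ (cong +_ (edgesTo≡degreeIn G v U)) (sym (fired-outside v∈?U))
                          (ℤ.i≤j+i _ (D v) {{nonNegative (effD v)}})

  large-cut⇒RIntersects : Effective G D → Effective G D' → ∀ r B →
    r ℕ.≤ length (cutEdges U (inducedEdges G B)) → RIntersects G r B D'
  large-cut⇒RIntersects effD effD' r B r≤cut = begin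
    + r                                            ≤⟨ +≤+ r≤cut ⟩
    + length (cutIn B U (edges G))                 ≤⟨ length-cutIn≤sumOver-gain B U (edges G) ⟩
    sumOver B (λ v → + gain U (edges G) v)         ≤⟨ sumOver-mono B (λ {v} _ → gain≤fired effD effD' v) ⟩
    sumOver B D'                                   ∎
    where open ℤ.≤-Reasoning

lemma5p1 : (G : Graph) → Connected G → (r : ℕ) → r ≥ 1 →
    (D D' : Divisor G) → Effective G D → Effective G D' →
    (U : Subset (n G)) → (∀ v → D' v ≡ fire G U D v) →
    (B : Subset (n G)) → EdgeConnected G r B →
    RIntersects G r B D → ¬ RIntersects G r B D' →
    B ⊆ U
lemma5p1 G _ r _ D D' effD effD' U D'≗fire B r-connected intersects ¬intersects' {x} x∈B
  with lookup U x in x∈?U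
... | true  = lookup⇒[]= x U x∈?U
... | false with r ℕ.≤? length (cutEdges U (inducedEdges G B))
...   | yes r≤cut = ⊥-elim (¬intersects' (large-cut⇒RIntersects G U D'≗fire effD effD' r B r≤cut))
...   | no r≰cut  = ⊥-elim (¬intersects' (ℤ.≤-trans intersects (sumOver-mono B D≤D')))
  where
  D≤D' : ∀ {v} → v ∈ B → D v ≤ D' v
  D≤D' v∈B = ≤-fired-outside G U {D = D} D'≗fire
    (trans (sym (small-cut⇒sameSide G r B U r-connected (ℕ.≰⇒> r≰cut) x∈B v∈B)) x∈?U)
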